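{- Let $G=(V,E,b,c)$ be a weighted hypergraph whose edges $e_0,e_1,\dots,e_{m-1}$ are processed by procedure COVER (described in the context). For every time $t\in\{0,\dots,m-1\}$ and every integer $r$, $$b\left(\{v\in e_t \mid \mathrm{eff}_{t+1}(v)\le r\}\right) < 2^{r+1}\cdot c(e_t).$$
   Context: A weighted hypergraph $G=(V,E,b,c)$: finite vertex set $V$, multiset $E$ of nonempty subsets of $V$, $b:V\to\mathbb{Q}_{>0}$, $c:E\to\mathbb{Q}_{>0}$, $b(U)=\sum_{v\in U}b(v)$. Edges arrive as a stream $e_0,\dots,e_{m-1}$ with $\mathrm{id}(e_t)=t$. $\lg$ = log base 2. Procedure COVER keeps for each $v\in V$ a value $\mathrm{eid}(v)$ (initially NULL) and $\mathrm{eff}(v)\in\mathbb{Z}\cup\{ -\infty\}$ (initially $-\infty$); $\mathrm{eff}_t(v)$ denotes the value just before $e_t$ is processed (so $\mathrm{eff}_{t+1}(v)$ is the value right after $e_t$ is processed). For $T\subseteq e_t$, $\mathrm{lev}_t(T)=\lceil\lg(b(T)/c(e_t))\rceil$; $T$ is effective at time $t$ if $\mathrm{lev}_t(T)>\mathrm{eff}_t(v)$ for every $v\in T$ ($\emptyset$ is vacuously effective). At time $t$, COVER computes an effective subset $T\subseteq e_t$ of largest benefit $b(T)$ (ties broken arbitrarily) and sets $\mathrm{eid}(v)\leftarrow\mathrm{id}(e_t)$ and $\mathrm{eff}(v)\leftarrow\mathrm{lev}_t(T)$ for all $v\in T$; other vertices are unchanged. -}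

module Defs where

open import Data.Nat as ℕ using (ℕ; zero; suc)
open import Data.Nat.Properties using (m^n≢0)
import Data.Rational.Properties as ℚP
open import Data.Integer as ℤ using (ℤ; +_; -[1+_])
open import Data.Rational as ℚ using (ℚ; 0ℚ; _/_)
open import Data.Fin using (Fin; zero; suc; toℕ)
open import Data.Fin.Subset using (Subset; _∈_; _∉_; _⊆_)
open import Data.Vec using (Vec; []; _∷_; tabulate; lookup)
open import Data.Bool using (Bool; true; false; if_then_else_; _∧_)
open import Data.Maybe using (Maybe; just; nothing)
open import Data.Product using (Σ; ∃; _×_)
open import Relation.Nullary.Decidable using (⌊_⌋)
open import Relation.Binary.PropositionalEquality using (_≡_)

pow2 : ℤ → ℚ
pow2 (+ n)     = (+ (2 ℕ.^ n)) / 1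
pow2 -[1+ n ]  = _/_ (+ 1) (2 ℕ.^ suc n) {{m^n≢0 2 (suc n)}}

bsum : ∀ {n} → (Fin n → ℚ) → Subset n → ℚ
bsum b []          = 0ℚ
bsum b (x ∷ xs)    = (if x then b zero else 0ℚ) ℚ.+ bsum (λ v → b (suc v)) xs

-- IsCeilLg q k  :⇔  k = ⌈lg q⌉ , i.e. 2^(k-1) < q ≤ 2^k   (q > 0)
IsCeilLg : ℚ → ℤ → Set
IsCeilLg q k = (pow2 (k ℤ.- ℤ.1ℤ) ℚ.< q) × (q ℚ.≤ pow2 k)

-- Extended integers ℤ ∪ {-∞}: nothing = -∞
ℤ∞ : Set
ℤ∞ = Maybe ℤ

_<∞_ : ℤ∞ → ℤ → Set
nothing <∞ k = Data.Unit.⊤ where import Data.Unit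
just x  <∞ k = x ℤ.< k

_≤∞ᵇ_ : ℤ∞ → ℤ → Bool
nothing ≤∞ᵇ r = true
just x  ≤∞ᵇ r = ⌊ x ℤ.≤? r ⌋

record WHypergraph (n m : ℕ) : Set where
  field
    b      : Fin n → ℚ
    c      : Fin m → ℚ
    e      : Fin m → Subset n
    b-pos  : ∀ v → 0ℚ ℚ.< b v
    c-pos  : ∀ t → 0ℚ ℚ.< c t
    e-ne   : ∀ t → ∃ λ v → v ∈ e t

module _ {n m : ℕ} (G : WHypergraph n m) where
  open WHypergraph G

  -- lev_t(T) = ⌈lg(b(T)/c(e_t))⌉ = k   (only meaningful for b(T) > 0)
  Lev : Fin m → Subset n → ℤ → Set
  Lev t T k = IsCeilLg (bsum b T ℚ.÷ c t) k
    where instance _ = ℚP.pos⇒nonZero (c t) {{ℚ.positive (c-pos t)}}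

  Effective : (Fin n → ℤ∞) → Fin m → Subset n → Set
  Effective eff t T = ∀ v → v ∈ T → ∀ k → Lev t T k → eff v <∞ k

  -- One step of COVER at time t, from eff = eff_t to eff' = eff_{t+1}:
  -- some effective T ⊆ e_t of maximum benefit is chosen, and
  -- eff(v) ← lev_t(T) for v ∈ T, other vertices unchanged.
  CoverStep : Fin m → (Fin n → ℤ∞) → (Fin n → ℤ∞) → Set
  CoverStep t eff eff' = Σ (Subset n) λ T →
      T ⊆ e t
    × Effective eff t T
    × (∀ T' → T' ⊆ e t → Effective eff t T' → bsum b T' ℚ.≤ bsum b T)
    × (∀ v → v ∈ T → ∀ k → Lev t T k → eff' v ≡ just k)
    × (∀ v → v ∉ T → eff' v ≡ eff v)

  CoverRun : (ℕ → Fin n → ℤ∞) → Set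
  CoverRun eff = (∀ v → eff 0 v ≡ nothing)
               × (∀ (t : Fin m) → CoverStep t (eff (toℕ t)) (eff (suc (toℕ t))))

  lowSet : (ℕ → Fin n → ℤ∞) → Fin m → ℤ → Subset n
  lowSet eff t r = tabulate λ v → lookup (e t) v ∧ (eff (suc (toℕ t)) v ≤∞ᵇ r)

-- Suppose the low set S = {v ∈ e_t | eff_{t+1}(v) ≤ r} had benefit at least 2^(r+1) c(e_t).
-- Every v ∈ S outside the chosen set T kept its old value eff_t(v) ≤ r, while the level of
-- S ∪ T is at least r + 1 and at least that of T; so S ∪ T is effective, and maximality of T
-- forces S ⊆ T. But then every v ∈ S received the value lev_t(T) ≤ r, whence
-- b(S) ≤ b(T) ≤ 2^lev_t(T) c(e_t) ≤ 2^r c(e_t), a contradiction.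
module Submission where

open import Defs
open import Data.Nat using (ℕ)
open import Data.Integer using (ℤ; 1ℤ; _+_)
open import Data.Rational using (_<_; _*_)
open import Data.Fin using (Fin)
open WHypergraph

open import Data.Bool using (Bool; true; false; if_then_else_; _∧_)
open import Data.Bool.Properties using (∧-conicalˡ; ∧-conicalʳ; T-≡)
open import Data.Empty using (⊥-elim)
open import Data.Fin using (zero; suc)
open import Data.Fin.Subset using (Subset; _∈_; _∉_; _⊆_; _∪_; ⊥; Nonempty)
open import Data.Fin.Subset.Properties
  using (_∈?_; drop-∷-⊆; ∉⊥; ⊥⊆; nonempty?; Empty-unique; p⊆p∪q; q⊆p∪q; x∈p∪q⁻; ⊆-trans)
open import Data.Integer as ℤ using (-[1+_]; +_; +<+; -<+; -<-)
import Data.Integer.Properties as ℤP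
open import Data.Integer.GCD using (gcd; gcd-zeroˡ; gcd-zeroʳ)
open import Data.Integer.Tactic.RingSolver using (solve-∀)
open import Data.Maybe using (just; nothing)
open import Data.Nat as ℕ using (zero; suc; z≤n; s≤s)
import Data.Nat.Properties as ℕP
open import Data.Product using (∃; _×_; _,_; proj₁; proj₂)
open import Data.Rational as ℚ using (ℚ; 0ℚ; ↥_; ↧_; *≤*; *<*; mkℚ)
import Data.Rational.Properties as ℚP
open import Data.Sum using (inj₁; inj₂)
open import Data.Unit using (tt)
open import Data.Vec using ([]; _∷_; here; there; tabulate; lookup)
open import Data.Vec.Properties using ([]=⇒lookup; lookup⇒[]=; lookup∘tabulate)
open import Function.Bundles using (Equivalence)
open import Relation.Binary.PropositionalEquality using (_≡_; refl; sym; trans; cong; cong₂; subst; subst₂)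
open import Relation.Nullary using (¬_; yes; no)
open import Relation.Nullary.Decidable using (toWitness)
open import Relation.Unary using (Decidable)

<⇒≱ : ∀ {p q} → p ℚ.< q → ¬ (q ℚ.≤ p)
<⇒≱ p<q q≤p = ℚP.<-irrefl refl (ℚP.<-≤-trans p<q q≤p)

↥-/-coprime : ∀ i n .{{_ : ℕ.NonZero n}} → gcd i (+ n) ≡ 1ℤ → ↥ (i ℚ./ n) ≡ i
↥-/-coprime i n g = trans (sym (ℤP.*-identityʳ _)) (trans (cong (↥ (i ℚ./ n) ℤ.*_) (sym g)) (ℚP.↥-/ i n))

↧-/-coprime : ∀ i n .{{_ : ℕ.NonZero n}} → gcd i (+ n) ≡ 1ℤ → ↧ (i ℚ./ n) ≡ + n
↧-/-coprime i n g = trans (sym (ℤP.*-identityʳ _)) (trans (cong (↧ (i ℚ./ n) ℤ.*_) (sym g)) (ℚP.↧-/ i n))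

module _ {p q : ℚ} {a b c d : ℕ}
         (↥p : ↥ p ≡ + a) (↧p : ↧ p ≡ + b) (↥q : ↥ q ≡ + c) (↧q : ↧ q ≡ + d) where

  private
    cross-p : ↥ p ℤ.* ↧ q ≡ + (a ℕ.* d)
    cross-p = trans (cong₂ ℤ._*_ ↥p ↧q) (sym (ℤP.pos-* a d))

    cross-q : ↥ q ℤ.* ↧ p ≡ + (c ℕ.* b)
    cross-q = trans (cong₂ ℤ._*_ ↥q ↧p) (sym (ℤP.pos-* c b))

  *≤*ₙ : a ℕ.* d ℕ.≤ c ℕ.* b → p ℚ.≤ q
  *≤*ₙ h = *≤* (subst₂ ℤ._≤_ (sym cross-p) (sym cross-q) (ℤ.+≤+ h))

  *<*ₙ : a ℕ.* d ℕ.< c ℕ.* b → p ℚ.< q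
  *<*ₙ h = *<* (subst₂ ℤ._<_ (sym cross-p) (sym cross-q) (+<+ h))

pow2-num pow2-den : ℤ → ℕ
pow2-num (+ n)     = 2 ℕ.^ n
pow2-num -[1+ n ]  = 1
pow2-den (+ n)     = 1
pow2-den -[1+ n ]  = 2 ℕ.^ suc n

↥-pow2 : ∀ k → ↥ pow2 k ≡ + pow2-num k
↥-pow2 (+ n)    = ↥-/-coprime (+ (2 ℕ.^ n)) 1 (gcd-zeroʳ (+ (2 ℕ.^ n)))
↥-pow2 -[1+ n ] = ↥-/-coprime 1ℤ (2 ℕ.^ suc n) {{ℕP.m^n≢0 2 (suc n)}} (gcd-zeroˡ (+ (2 ℕ.^ suc n)))

↧-pow2 : ∀ k → ↧ pow2 k ≡ + pow2-den k
↧-pow2 (+ n)    = ↧-/-coprime (+ (2 ℕ.^ n)) 1 (gcd-zeroʳ (+ (2 ℕ.^ n)))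
↧-pow2 -[1+ n ] = ↧-/-coprime 1ℤ (2 ℕ.^ suc n) {{ℕP.m^n≢0 2 (suc n)}} (gcd-zeroˡ (+ (2 ℕ.^ suc n)))

n<2^n : ∀ n → n ℕ.< 2 ℕ.^ n
n<2^n zero    = s≤s z≤n
n<2^n (suc n) = ℕP.+-mono-≤ (ℕP.m^n>0 2 n) (ℕP.≤-trans (n<2^n n) (ℕP.m≤m+n _ 0))

pow2-pos : ∀ k → 0ℚ ℚ.< pow2 k
pow2-pos k = *<*ₙ refl refl (↥-pow2 k) (↧-pow2 k)
  (subst (0 ℕ.<_) (sym (ℕP.*-identityʳ _)) (num-pos k))
  where
  num-pos : ∀ k → 0 ℕ.< pow2-num k
  num-pos (+ n)    = ℕP.m^n>0 2 n
  num-pos -[1+ n ] = s≤s z≤n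

pow2-strictMono : ∀ {j k} → j ℤ.< k → pow2 j ℚ.< pow2 k
pow2-strictMono {j} {k} j<k = *<*ₙ (↥-pow2 j) (↧-pow2 j) (↥-pow2 k) (↧-pow2 k) (cross j<k)
  where
  2^-strictMono : ∀ {a b} → a ℕ.< b → 2 ℕ.^ a ℕ.< 2 ℕ.^ b
  2^-strictMono = ℕP.^-monoʳ-< 2 (s≤s (s≤s z≤n))
  cross : ∀ {j k} → j ℤ.< k → pow2-num j ℕ.* pow2-den k ℕ.< pow2-num k ℕ.* pow2-den j
  cross (+<+ a<b)       = subst₂ ℕ._<_ (sym (ℕP.*-identityʳ _)) (sym (ℕP.*-identityʳ _)) (2^-strictMono a<b)
  cross { -[1+ a ]} {+ b} -<+ = ℕP.*-mono-≤ (ℕP.m^n>0 2 b) (ℕP.^-monoʳ-≤ 2 {1} {suc a} (s≤s z≤n))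
  cross (-<- b<a)       = subst₂ ℕ._<_ (sym (ℕP.*-identityˡ _)) (sym (ℕP.*-identityˡ _)) (2^-strictMono (s≤s b<a))

pow2-mono : ∀ {j k} → j ℤ.≤ k → pow2 j ℚ.≤ pow2 k
pow2-mono {j} {k} j≤k with j ℤP.≟ k
... | yes refl = ℚP.≤-refl
... | no  j≢k  = ℚP.<⇒≤ (pow2-strictMono (ℤP.≤∧≢⇒< j≤k j≢k))

pow2-cancel-≤ : ∀ {j k} → pow2 j ℚ.≤ pow2 k → j ℤ.≤ k
pow2-cancel-≤ {j} {k} h with j ℤP.≤? k
... | yes j≤k = j≤k
... | no  j≰k = ⊥-elim (<⇒≱ (pow2-strictMono (ℤP.≰⇒> j≰k)) h)

pow2-cancel-< : ∀ {j k} → pow2 j ℚ.< pow2 k → j ℤ.< k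
pow2-cancel-< {j} {k} h with j ℤP.<? k
... | yes j<k = j<k
... | no  j≮k = ⊥-elim (<⇒≱ h (pow2-mono (ℤP.≮⇒≥ j≮k)))

pred<⇒≤ : ∀ {j k} → j ℤ.- 1ℤ ℤ.< k → j ℤ.≤ k
pred<⇒≤ {j} {k} h = subst (ℤ._≤ k) (ℤP.suc-pred j) (ℤP.i<j⇒suc[i]≤j (subst (ℤ._< k) (ℤP.+-comm j ℤ.-1ℤ) h))

isCeilLg-mono : ∀ {q q' j k} → IsCeilLg q j → IsCeilLg q' k → q ℚ.≤ q' → j ℤ.≤ k
isCeilLg-mono (lower , _) (_ , upper) q≤q' =
  pred<⇒≤ (pow2-cancel-< (ℚP.<-≤-trans lower (ℚP.≤-trans q≤q' upper)))

pow2≤⇒≤isCeilLg : ∀ {q j k} → pow2 j ℚ.≤ q → IsCeilLg q k → j ℤ.≤ k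
pow2≤⇒≤isCeilLg h (_ , upper) = pow2-cancel-≤ (ℚP.≤-trans h upper)

∃-crossing : (P : ℤ → Set) → Decidable P → ∀ i N → ¬ P i → P (i + + N) → ∃ λ k → ¬ P (k ℤ.- 1ℤ) × P k
∃-crossing P P? i zero    ¬Pi Pi+N = ⊥-elim (¬Pi (subst P (ℤP.+-identityʳ i) Pi+N))
∃-crossing P P? i (suc N) ¬Pi Pi+N with P? (i + + N)
... | yes Pi+N' = ∃-crossing P P? i N ¬Pi Pi+N'
... | no ¬Pi+N' = i + + suc N , subst (λ k → ¬ P k) (sym previous) ¬Pi+N' , Pi+N
  where
  previous : i + + suc N ℤ.- 1ℤ ≡ i + + N
  previous = trans (cong (λ z → i + z ℤ.- 1ℤ) (ℤP.pos-+ 1 N)) (shift i (+ N))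
    where
    shift : ∀ i x → i + (1ℤ + x) ℤ.- 1ℤ ≡ i + x
    shift = solve-∀

-- Search from 2^-d < q up to q ≤ 2^(p+1), for q = (p+1)/d.
isCeilLg-exists : ∀ {q} → 0ℚ ℚ.< q → ∃ (IsCeilLg q)
isCeilLg-exists {mkℚ (+ zero) _ _} q>0 with () ← ℚ.positive q>0
isCeilLg-exists {mkℚ -[1+ _ ] _ _} q>0 with () ← ℚ.positive q>0
isCeilLg-exists {q@(mkℚ (+ suc p) d-1 _)} _ with
  ∃-crossing (λ k → q ℚ.≤ pow2 k) (λ k → q ℚP.≤? pow2 k) -[1+ d-1 ] (d ℕ.+ suc p) q≰2^-d q≤2^top
  where
  d : ℕ
  d = suc d-1
  q≰2^-d : ¬ (q ℚ.≤ pow2 -[1+ d-1 ])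
  q≰2^-d = <⇒≱ (*<*ₙ (↥-pow2 -[1+ d-1 ]) (↧-pow2 -[1+ d-1 ]) refl refl
    (subst (ℕ._< suc p ℕ.* 2 ℕ.^ d) (sym (ℕP.*-identityˡ d)) (ℕP.<-≤-trans (n<2^n d) (ℕP.m≤m+n _ _))))
  top-index : -[1+ d-1 ] + + (d ℕ.+ suc p) ≡ + suc p
  top-index = trans (cong (λ z → -[1+ d-1 ] + z) (ℤP.pos-+ d (suc p))) (cancel (+ d) (+ suc p))
    where
    cancel : ∀ x y → ℤ.- x + (x + y) ≡ y
    cancel = solve-∀
  q≤2^top : q ℚ.≤ pow2 (-[1+ d-1 ] + + (d ℕ.+ suc p))
  q≤2^top = subst (λ k → q ℚ.≤ pow2 k) (sym top-index) (*≤*ₙ refl refl (↥-pow2 (+ suc p)) (↧-pow2 (+ suc p))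
    (subst (ℕ._≤ 2 ℕ.^ suc p ℕ.* d) (sym (ℕP.*-identityʳ (suc p)))
      (ℕP.≤-trans (ℕP.<⇒≤ (n<2^n (suc p))) (ℕP.m≤m*n _ d))))
... | k , q≰2^[k-1] , q≤2^k = k , ℚP.≰⇒> q≰2^[k-1] , q≤2^k

module _ (c : ℚ) .{{c>0 : ℚ.Positive c}} where

  private instance
    c≢0 : ℚ.NonZero c
    c≢0 = ℚP.pos⇒nonZero c

  ÷-*-cancel : ∀ x → x ℚ.÷ c ℚ.* c ≡ x
  ÷-*-cancel x = trans (ℚP.*-assoc x (ℚ.1/ c) c) (trans (cong (x ℚ.*_) (ℚP.*-inverseˡ c)) (ℚP.*-identityʳ x))

  ÷≤⇒≤* : ∀ {x y} → x ℚ.÷ c ℚ.≤ y → x ℚ.≤ y ℚ.* c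
  ÷≤⇒≤* {x} {y} h = subst (ℚ._≤ y ℚ.* c) (÷-*-cancel x) (ℚP.*-monoʳ-≤-nonNeg c {{ℚP.pos⇒nonNeg c}} h)

  *≤⇒≤÷ : ∀ {x y} → y ℚ.* c ℚ.≤ x → y ℚ.≤ x ℚ.÷ c
  *≤⇒≤÷ {x} {y} h = ℚP.*-cancelʳ-≤-pos c (subst (y ℚ.* c ℚ.≤_) (sym (÷-*-cancel x)) h)

  ÷-monoˡ-≤ : ∀ {x y} → x ℚ.≤ y → x ℚ.÷ c ℚ.≤ y ℚ.÷ c
  ÷-monoˡ-≤ = ℚP.*-monoʳ-≤-nonNeg (ℚ.1/ c) {{ℚP.pos⇒nonNeg (ℚ.1/ c) {{ℚP.1/pos⇒pos c}}}}

  ÷-pos : ∀ {x} → 0ℚ ℚ.< x → 0ℚ ℚ.< x ℚ.÷ c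
  ÷-pos {x} h = subst (ℚ._< x ℚ.÷ c) (ℚP.*-zeroˡ (ℚ.1/ c)) (ℚP.*-monoˡ-<-pos (ℚ.1/ c) {{ℚP.1/pos⇒pos c}} h)

bsum-⊥ : ∀ {n} (b : Fin n → ℚ) → bsum b ⊥ ≡ 0ℚ
bsum-⊥ {zero}  b = refl
bsum-⊥ {suc n} b = trans (ℚP.+-identityˡ _) (bsum-⊥ (λ v → b (suc v)))

bsum-pos⇒nonempty : ∀ {n} (b : Fin n → ℚ) {S} → 0ℚ ℚ.< bsum b S → Nonempty S
bsum-pos⇒nonempty b {S} h with nonempty? S
... | yes S≠∅ = S≠∅
... | no  S=∅ = ⊥-elim (ℚP.<-irrefl (sym (trans (cong (bsum b) (Empty-unique S=∅)) (bsum-⊥ b))) h)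

head-≤ : ∀ {n} {x y : Bool} {S T : Subset n} {w} → 0ℚ ℚ.≤ w → x ∷ S ⊆ y ∷ T →
         (if x then w else 0ℚ) ℚ.≤ (if y then w else 0ℚ)
head-≤ {x = false} {false} _   _   = ℚP.≤-refl
head-≤ {x = false} {true}  w≥0 _   = w≥0
head-≤ {x = true}  {true}  _   _   = ℚP.≤-refl
head-≤ {x = true}  {false} _   S⊆T with () ← S⊆T here

bsum-mono : ∀ {n} (b : Fin n → ℚ) → (∀ v → 0ℚ ℚ.≤ b v) → ∀ {S T} → S ⊆ T → bsum b S ℚ.≤ bsum b T
bsum-mono b b≥0 {[]}    {[]}    _   = ℚP.≤-refl
bsum-mono b b≥0 {x ∷ S} {y ∷ T} S⊆T =
  ℚP.+-mono-≤ (head-≤ (b≥0 zero) S⊆T) (bsum-mono (λ v → b (suc v)) (λ v → b≥0 (suc v)) (drop-∷-⊆ S⊆T))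

bsum-strictMono : ∀ {n} (b : Fin n → ℚ) → (∀ v → 0ℚ ℚ.< b v) →
                  ∀ {T U v} → T ⊆ U → v ∈ U → v ∉ T → bsum b T ℚ.< bsum b U
bsum-strictMono b b>0 {false ∷ T} {true ∷ U} {zero} T⊆U here _ =
  ℚP.+-mono-<-≤ (b>0 zero) (bsum-mono (λ v → b (suc v)) (λ v → ℚP.<⇒≤ (b>0 (suc v))) (drop-∷-⊆ T⊆U))
bsum-strictMono b b>0 {T = true ∷ T} {v = zero} _ _ v∉T = ⊥-elim (v∉T here)
bsum-strictMono b b>0 {x ∷ T} {y ∷ U} {suc v} T⊆U (there v∈U) v∉T =
  ℚP.+-mono-≤-< (head-≤ (ℚP.<⇒≤ (b>0 zero)) T⊆U)
    (bsum-strictMono (λ v → b (suc v)) (λ v → b>0 (suc v)) (drop-∷-⊆ T⊆U) v∈U (λ v∈T → v∉T (there v∈T)))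

bsum-pos : ∀ {n} (b : Fin n → ℚ) → (∀ v → 0ℚ ℚ.< b v) → ∀ {S} → Nonempty S → 0ℚ ℚ.< bsum b S
bsum-pos b b>0 {S} (v , v∈S) = subst (ℚ._< bsum b S) (bsum-⊥ b) (bsum-strictMono b b>0 ⊥⊆ v∈S ∉⊥)

bsum-≤⇒⊇ : ∀ {n} (b : Fin n → ℚ) → (∀ v → 0ℚ ℚ.< b v) →
           ∀ {T U} → T ⊆ U → bsum b U ℚ.≤ bsum b T → U ⊆ T
bsum-≤⇒⊇ b b>0 {T} T⊆U U≤T {v} v∈U with v ∈? T
... | yes v∈T = v∈T
... | no  v∉T = ⊥-elim (<⇒≱ (bsum-strictMono b b>0 T⊆U v∈U v∉T) U≤T)

<∞-≤-trans : ∀ (x : ℤ∞) {j k} → x <∞ j → j ℤ.≤ k → x <∞ k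
<∞-≤-trans nothing  _   _   = tt
<∞-≤-trans (just x) x<j j≤k = ℤP.<-≤-trans x<j j≤k

just-≤∞ᵇ⇒≤ : ∀ {x r} → (just x ≤∞ᵇ r) ≡ true → x ℤ.≤ r
just-≤∞ᵇ⇒≤ {x} {r} x≤r = toWitness {a? = x ℤ.≤? r} (Equivalence.from T-≡ x≤r)

≤∞ᵇ⇒<∞ : ∀ (x : ℤ∞) {r k} → (x ≤∞ᵇ r) ≡ true → r + 1ℤ ℤ.≤ k → x <∞ k
≤∞ᵇ⇒<∞ nothing  _   _ = tt
≤∞ᵇ⇒<∞ (just x) {r} {k} x≤r r+1≤k =
  ℤP.suc[i]≤j⇒i<j (ℤP.≤-trans (ℤP.suc-mono (just-≤∞ᵇ⇒≤ x≤r)) (subst (ℤ._≤ k) (ℤP.+-comm r 1ℤ) r+1≤k))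

module _ {n m : ℕ} (G : WHypergraph n m) (t : Fin m) where

  private
    instance
      cₜ>0 : ℚ.Positive (c G t)
      cₜ>0 = ℚ.positive (c-pos G t)

    b≥0 : ∀ v → 0ℚ ℚ.≤ b G v
    b≥0 v = ℚP.<⇒≤ (b-pos G v)

  pow2*c-pos : ∀ k → 0ℚ ℚ.< pow2 k * c G t
  pow2*c-pos k = subst (ℚ._< pow2 k * c G t) (ℚP.*-zeroˡ (c G t)) (ℚP.*-monoˡ-<-pos (c G t) (pow2-pos k))

  lev-exists : ∀ {T} → Nonempty T → ∃ (Lev G t T)
  lev-exists T≠∅ = isCeilLg-exists (÷-pos (c G t) (bsum-pos (b G) (b-pos G) T≠∅))

  lev-mono : ∀ {T U j k} → T ⊆ U → Lev G t T j → Lev G t U k → j ℤ.≤ k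
  lev-mono T⊆U levT levU = isCeilLg-mono levT levU (÷-monoˡ-≤ (c G t) (bsum-mono (b G) b≥0 T⊆U))

  bsum≤pow2-lev : ∀ {T k} → Lev G t T k → bsum (b G) T ℚ.≤ pow2 k * c G t
  bsum≤pow2-lev (_ , upper) = ÷≤⇒≤* (c G t) upper

  pow2≤bsum⇒≤lev : ∀ {T j k} → pow2 j * c G t ℚ.≤ bsum (b G) T → Lev G t T k → j ℤ.≤ k
  pow2≤bsum⇒≤lev h = pow2≤⇒≤isCeilLg (*≤⇒≤÷ (c G t) h)

  ∪-effective : ∀ {eff S T r} → Effective G eff t T →
                (∀ {w} → w ∈ S → w ∉ T → (eff w ≤∞ᵇ r) ≡ true) →
                pow2 (r + 1ℤ) * c G t ℚ.≤ bsum (b G) S → Effective G eff t (S ∪ T)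
  ∪-effective {eff} {S} {T} T-effective S∖T-low heavy w w∈S∪T k levS∪T with w ∈? T
  ... | yes w∈T =
    let j , levT = lev-exists (w , w∈T) in
    <∞-≤-trans (eff w) (T-effective w w∈T j levT) (lev-mono (q⊆p∪q S T) levT levS∪T)
  ... | no w∉T with x∈p∪q⁻ S T w∈S∪T
  ...   | inj₁ w∈S = ≤∞ᵇ⇒<∞ (eff w) (S∖T-low w∈S w∉T)
      (pow2≤bsum⇒≤lev {S ∪ T} (ℚP.≤-trans heavy (bsum-mono (b G) b≥0 {S} (p⊆p∪q T))) levS∪T)
  ...   | inj₂ w∈T = ⊥-elim (w∉T w∈T)

lowAfter : ∀ {n m} → WHypergraph n m → Fin m → (Fin n → ℤ∞) → ℤ → Subset n
lowAfter G t eff′ r = tabulate λ v → lookup (e G t) v ∧ (eff′ v ≤∞ᵇ r)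

∈-lowAfter⁻ : ∀ {n m} (G : WHypergraph n m) t eff′ r {v} → v ∈ lowAfter G t eff′ r →
              v ∈ e G t × (eff′ v ≤∞ᵇ r) ≡ true
∈-lowAfter⁻ G t eff′ r {v} v∈ =
  lookup⇒[]= v (e G t) (∧-conicalˡ _ _ lookup≡true) , ∧-conicalʳ _ _ lookup≡true
  where
  lookup≡true : lookup (e G t) v ∧ (eff′ v ≤∞ᵇ r) ≡ true
  lookup≡true = trans (sym (lookup∘tabulate (λ w → lookup (e G t) w ∧ (eff′ w ≤∞ᵇ r)) v)) ([]=⇒lookup v∈)

coverStep-lowAfter-bound : ∀ {n m} (G : WHypergraph n m) {t eff eff′} → CoverStep G t eff eff′ →
  ∀ r → bsum (b G) (lowAfter G t eff′ r) < pow2 (r + 1ℤ) * c G t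
coverStep-lowAfter-bound {n} G {t} {eff} {eff′} (T , T⊆eₜ , T-effective , T-maximal , T-updated , T-unchanged) r =
  ℚP.≰⇒> λ heavy → <⇒≱ (heavy⇒light heavy) heavy
  where
  instance
    cₜ>0 : ℚ.Positive (c G t)
    cₜ>0 = ℚ.positive (c-pos G t)

  S : Subset n
  S = lowAfter G t eff′ r

  ∈S⁻ : ∀ {v} → v ∈ S → v ∈ e G t × (eff′ v ≤∞ᵇ r) ≡ true
  ∈S⁻ = ∈-lowAfter⁻ G t eff′ r

  S∪T⊆eₜ : S ∪ T ⊆ e G t
  S∪T⊆eₜ {w} w∈S∪T with x∈p∪q⁻ S T w∈S∪T
  ... | inj₁ w∈S = proj₁ (∈S⁻ w∈S)
  ... | inj₂ w∈T = T⊆eₜ w∈T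

  S∖T-low : ∀ {w} → w ∈ S → w ∉ T → (eff w ≤∞ᵇ r) ≡ true
  S∖T-low {w} w∈S w∉T = subst (λ x → (x ≤∞ᵇ r) ≡ true) (T-unchanged w w∉T) (proj₂ (∈S⁻ w∈S))

  heavy⇒S⊆T : pow2 (r + 1ℤ) * c G t ℚ.≤ bsum (b G) S → S ⊆ T
  heavy⇒S⊆T heavy = ⊆-trans (p⊆p∪q T) (bsum-≤⇒⊇ (b G) (b-pos G) (q⊆p∪q S T)
    (T-maximal (S ∪ T) S∪T⊆eₜ (∪-effective G t T-effective S∖T-low heavy)))

  S⊆T⇒light : S ⊆ T → Nonempty S → bsum (b G) S < pow2 (r + 1ℤ) * c G t
  S⊆T⇒light S⊆T (v , v∈S) = begin-strict
    bsum (b G) S            ≤⟨ bsum-mono (b G) (λ w → ℚP.<⇒≤ (b-pos G w)) S⊆T ⟩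
    bsum (b G) T            ≤⟨ bsum≤pow2-lev G t {T} {k} levT ⟩
    pow2 k * c G t          ≤⟨ ℚP.*-monoʳ-≤-nonNeg (c G t) {{ℚP.pos⇒nonNeg (c G t)}} (pow2-mono k≤r) ⟩
    pow2 r * c G t          <⟨ ℚP.*-monoˡ-<-pos (c G t) (pow2-strictMono {r} r<r+1) ⟩
    pow2 (r + 1ℤ) * c G t   ∎
    where
    open ℚP.≤-Reasoning
    levelT : ∃ (Lev G t T)
    levelT = lev-exists G t (v , S⊆T v∈S)
    k : ℤ
    k = proj₁ levelT
    levT : Lev G t T k
    levT = proj₂ levelT
    k≤r : k ℤ.≤ r
    k≤r = just-≤∞ᵇ⇒≤
      (subst (λ x → (x ≤∞ᵇ r) ≡ true) (T-updated v (S⊆T v∈S) k levT) (proj₂ (∈S⁻ v∈S)))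
    r<r+1 : r ℤ.< r + 1ℤ
    r<r+1 = ℤP.suc[i]≤j⇒i<j (ℤP.≤-reflexive (ℤP.+-comm 1ℤ r))

  heavy⇒light : pow2 (r + 1ℤ) * c G t ℚ.≤ bsum (b G) S → bsum (b G) S < pow2 (r + 1ℤ) * c G t
  heavy⇒light heavy =
    S⊆T⇒light (heavy⇒S⊆T heavy) (bsum-pos⇒nonempty (b G) (ℚP.<-≤-trans (pow2*c-pos G t (r + 1ℤ)) heavy))

-- Only step t of the run is used; the initial values eff_0 = -∞ play no role.
lemma1 : ∀ {n m} (G : WHypergraph n m) (eff : ℕ → Fin n → ℤ∞) → CoverRun G eff →
  ∀ (t : Fin m) (r : ℤ) → bsum (b G) (lowSet G eff t r) < pow2 (r + 1ℤ) * c G t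
lemma1 G eff (_ , steps) t = coverStep-lowAfter-bound G (steps t)
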